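{- If $\operatorname{char}(\mathbb{k})=0$, the linear map $\mathbf{W}\to\mathbb{k}$ with $[w,n]\mapsto\frac{1}{\ell(w)!}$ for every basis element $[w,n]$ is an algebra morphism.
   Context: Fix a field $\mathbb{k}$. A word is a finite sequence of positive integers; $\max(w)$ is its largest letter ($\max(\emptyset)=0$) and $\ell(w)$ its length. For words $u$ (length $a$) and $v$ (length $b$), $\operatorname{sh}(u,v)=\sum_{I\subseteq\{1,\dots,a+b\},|I|=a}x_I$ (with multiplicity) where $x_I$ is the word whose letters at positions in $I$ spell $u$ and elsewhere spell $v$; $w\uparrow m$ adds $m$ to each letter of $w$. $\mathbf{W}$ is the $\mathbb{k}$-vector space with basis the symbols $[w,n]$ ($n\in\mathbb{N}$, $w$ a word with $\max(w)\le n$), with product $[v,m]\cdot[w,n]=\sum_{u\in\operatorname{sh}(v,w\uparrow m)}[u,m+n]$ and unit $[\emptyset,0]$. -}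

module Defs where

open import Level using (Level; _⊔_) renaming (suc to lsuc)
open import Algebra.Bundles using (CommutativeRing)
open import Data.Nat using (ℕ; zero; suc; _≤_; _<_; _!; NonZero) renaming (_+_ to _+ⁿ_)
open import Data.Nat.Properties using (_!≢0; m≤m+n; m≤n+m; ≤-trans; +-monoʳ-≤; +-monoʳ-<)
open import Data.List using (List; []; _∷_; _++_; map; length; concatMap)
open import Data.List.Relation.Unary.All as All using (All; []; _∷_)
open import Data.Product using (Σ; _,_; _×_; proj₁; proj₂)
open import Relation.Nullary using (¬_)

record Field (c ℓ : Level) : Set (lsuc (c ⊔ ℓ)) where
  field
    commutativeRing : CommutativeRing c ℓ
  open CommutativeRing commutativeRing public
  field
    0≉1    : ¬ (0# ≈ 1#)
    inv    : (x : Carrier) → ¬ (x ≈ 0#) → Carrier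
    inv-r  : ∀ x (x≉0 : ¬ (x ≈ 0#)) → x * inv x x≉0 ≈ 1#

  ι : ℕ → Carrier
  ι zero    = 0#
  ι (suc n) = 1# + ι n

  CharZero : Set ℓ
  CharZero = ∀ n → ¬ (ι (suc n) ≈ 0#)

Word : Set
Word = List ℕ

Letter≤ : ℕ → ℕ → Set
Letter≤ n a = (0 < a) × (a ≤ n)

record Basis : Set where
  constructor [_,_∣_]
  field
    word  : Word
    bound : ℕ
    valid : All (Letter≤ bound) word
open Basis public

shuffle : {P : ℕ → Set} (u v : Word) → All P u → All P v →
          List (Σ Word (All P))
shuffle []      v       []        pv        = (v , pv) ∷ []
shuffle (a ∷ u) []      pu        []        = (a ∷ u , pu) ∷ []
shuffle (a ∷ u) (b ∷ v) (pa ∷ pu) (pb ∷ pv) =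
  map (λ x → (a ∷ proj₁ x , pa ∷ proj₂ x)) (shuffle u (b ∷ v) pu (pb ∷ pv))
  ++ map (λ x → (b ∷ proj₁ x , pb ∷ proj₂ x)) (shuffle (a ∷ u) v (pa ∷ pu) pv)

_↑_ : Word → ℕ → Word
w ↑ m = map (m +ⁿ_) w

widen : ∀ m n {w} → All (Letter≤ m) w → All (Letter≤ (m +ⁿ n)) w
widen m n = All.map (λ { (p , q) → p , ≤-trans q (m≤m+n m n) })

shift : ∀ m n {w} → All (Letter≤ n) w → All (Letter≤ (m +ⁿ n)) (w ↑ m)
shift m n {[]}    []             = []
shift m n {a ∷ w} ((p , q) ∷ ps) =
  (≤-trans p (m≤n+m a m) , +-monoʳ-≤ m q) ∷ shift m n ps

_·ᴮ_ : Basis → Basis → List Basis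
[ v , m ∣ pv ] ·ᴮ [ w , n ∣ pw ] =
  map (λ x → [ proj₁ x , m +ⁿ n ∣ proj₂ x ])
      (shuffle v (w ↑ m) (widen m n pv) (shift m n pw))

1ᴮ : Basis
1ᴮ = [ [] , 0 ∣ [] ]

-- The algebra 𝐖 over a field k: its elements are finite formal
-- k-linear combinations of basis symbols, represented by lists of
-- (coefficient , basis symbol) pairs.

module Algebra𝐖 {c ℓ} (F : Field c ℓ) where
  open Field F

  𝐖 : Set c
  𝐖 = List (Carrier × Basis)

  0𝐖 : 𝐖
  0𝐖 = []

  _+𝐖_ : 𝐖 → 𝐖 → 𝐖
  _+𝐖_ = _++_

  _•_ : Carrier → 𝐖 → 𝐖
  λ₀ • x = map (λ p → (λ₀ * proj₁ p , proj₂ p)) x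

  _·𝐖_ : 𝐖 → 𝐖 → 𝐖
  x ·𝐖 y = concatMap (λ p → concatMap (λ q →
             map (λ b → (proj₁ p * proj₁ q , b)) (proj₂ p ·ᴮ proj₂ q)) y) x

  1𝐖 : 𝐖
  1𝐖 = (1# , 1ᴮ) ∷ []

  linExt : (Basis → Carrier) → 𝐖 → Carrier
  linExt f []             = 0#
  linExt f ((a , b) ∷ x)  = a * f b + linExt f x

  record IsAlgebraMorphism (φ : 𝐖 → Carrier) : Set (c ⊔ ℓ) where
    field
      +-hom : ∀ x y → φ (x +𝐖 y) ≈ φ x + φ y
      •-hom : ∀ a x → φ (a • x) ≈ a * φ x
      ·-hom : ∀ x y → φ (x ·𝐖 y) ≈ φ x * φ y
      1-hom : φ 1𝐖 ≈ 1#

  inv-ι : CharZero → (m : ℕ) → .{{NonZero m}} → Carrier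
  inv-ι chz (suc k) = inv (ι (suc k)) (chz k)

  φ₀ : CharZero → Basis → Carrier
  φ₀ chz b = inv-ι chz (length (word b) !) {{length (word b) !≢0}}

  φ : CharZero → 𝐖 → Carrier
  φ chz = linExt (φ₀ chz)

-- A shuffle of a word of length a with one of length b has length a + b,
-- and there are (a + b)! / (a! b!) of them.  Hence the basis product
-- [v , m] · [w , n] is sent to  (a + b)! / (a! b!) · 1 / (a + b)!
-- = 1 / a! · 1 / b!.  Multiplicativity on basis symbols extends to 𝐖 by
-- bilinearity of the product.
module Submission where

open import Defs
open import Data.Nat as Nat using (ℕ; zero; suc; _!; NonZero)
open import Data.Nat.Properties using (_!≢0)
open import Data.Nat.Tactic.RingSolver using (solve-∀)
open import Data.List using (List; []; _∷_; _++_; map; length; concatMap)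
open import Data.List.Properties using (length-++; length-map)
open import Data.List.Relation.Unary.All as All using (All; []; _∷_)
open import Data.List.Relation.Unary.All.Properties using (++⁺; map⁺)
open import Data.Product using (_,_; proj₁; proj₂)
open import Relation.Binary.PropositionalEquality as ≡ using (_≡_)

module _ where
  open Nat using (_+_; _*_)
  open import Data.Nat.Properties using (+-identityʳ; *-identityʳ; +-suc)

  wordLength : Basis → ℕ
  wordLength b = length (word b)

  shuffleCount : ℕ → ℕ → ℕ
  shuffleCount zero    b       = 1
  shuffleCount (suc a) zero    = 1
  shuffleCount (suc a) (suc b) = shuffleCount a (suc b) + shuffleCount (suc a) b

  shuffleCount-*-!-* : ∀ a b → shuffleCount a b * a ! * b ! ≡ (a + b) !
  shuffleCount-*-!-* zero    b       = +-identityʳ (b !)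
  shuffleCount-*-!-* (suc a) zero    =
    ≡.trans (*-identityʳ _) (≡.trans (+-identityʳ _) (≡.cong _! (≡.sym (+-identityʳ (suc a)))))
  shuffleCount-*-!-* (suc a) (suc b) = begin
    (X + Y) * suc a ! * suc b !
      ≡⟨ regroup X Y a b (a !) (b !) ⟩
    suc a * (X * a ! * suc b !) + suc b * (Y * suc a ! * b !)
      ≡⟨ ≡.cong₂ (λ s t → suc a * s + suc b * t)
           (≡.trans (shuffleCount-*-!-* a (suc b)) (≡.cong _! (+-suc a b)))
           (shuffleCount-*-!-* (suc a) b) ⟩
    suc a * (suc a + b) ! + suc b * (suc a + b) !
      ≡⟨ sum-of-factors a b ((suc a + b) !) ⟩
    suc (suc a + b) * (suc a + b) !
      ≡⟨ ≡.cong _! (+-suc (suc a) b) ⟨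
    (suc a + suc b) ! ∎
    where
    open ≡.≡-Reasoning
    X = shuffleCount a (suc b)
    Y = shuffleCount (suc a) b
    regroup : ∀ x y a b a! b! →
      (x + y) * (suc a * a!) * (suc b * b!) ≡
      suc a * (x * a! * (suc b * b!)) + suc b * (y * (suc a * a!) * b!)
    regroup = solve-∀
    sum-of-factors : ∀ a b k → suc a * k + suc b * k ≡ suc (suc a + b) * k
    sum-of-factors = solve-∀

  module _ {P : ℕ → Set} where

    length-shuffle : ∀ u v (pu : All P u) (pv : All P v) →
                     length (shuffle u v pu pv) ≡ shuffleCount (length u) (length v)
    length-shuffle []      v       []        pv        = ≡.refl
    length-shuffle (a ∷ u) []      pu        []        = ≡.refl
    length-shuffle (a ∷ u) (b ∷ v) (pa ∷ pu) (pb ∷ pv) = begin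
      length (map _ left ++ map _ right)         ≡⟨ length-++ (map _ left) ⟩
      length (map _ left) + length (map _ right) ≡⟨ ≡.cong₂ _+_ (length-map _ left) (length-map _ right) ⟩
      length left + length right                 ≡⟨ ≡.cong₂ _+_ (length-shuffle u (b ∷ v) pu (pb ∷ pv))
                                                                  (length-shuffle (a ∷ u) v (pa ∷ pu) pv) ⟩
      shuffleCount (length u) (suc (length v)) + shuffleCount (suc (length u)) (length v) ∎
      where
      open ≡.≡-Reasoning
      left  = shuffle u (b ∷ v) pu (pb ∷ pv)
      right = shuffle (a ∷ u) v (pa ∷ pu) pv

    All-length-shuffle : ∀ u v (pu : All P u) (pv : All P v) →
                     All (λ x → length (proj₁ x) ≡ length u + length v) (shuffle u v pu pv)
    All-length-shuffle []      v       []        pv        = ≡.refl ∷ []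
    All-length-shuffle (a ∷ u) []      pu        []        = ≡.cong suc (≡.sym (+-identityʳ (length u))) ∷ []
    All-length-shuffle (a ∷ u) (b ∷ v) (pa ∷ pu) (pb ∷ pv) =
      ++⁺ (map⁺ (All.map (≡.cong suc) (All-length-shuffle u (b ∷ v) pu (pb ∷ pv))))
          (map⁺ (All.map (λ e → ≡.trans (≡.cong suc e) (≡.sym (≡.cong suc (+-suc (length u) (length v)))))
                         (All-length-shuffle (a ∷ u) v (pa ∷ pu) pv)))

  length-·ᴮ : ∀ b b' → length (b ·ᴮ b') ≡ shuffleCount (wordLength b) (wordLength b')
  length-·ᴮ [ v , m ∣ pv ] [ w , n ∣ pw ] =
    ≡.trans (length-map _ sh)
      (≡.trans (length-shuffle v (w ↑ m) (widen m n pv) (shift m n pw))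
               (≡.cong (shuffleCount (length v)) (length-map (m +_) w)))
    where sh = shuffle v (w ↑ m) (widen m n pv) (shift m n pw)

  All-wordLength-·ᴮ : ∀ b b' → All (λ b″ → wordLength b″ ≡ wordLength b + wordLength b') (b ·ᴮ b')
  All-wordLength-·ᴮ [ v , m ∣ pv ] [ w , n ∣ pw ] =
    map⁺ (All.map (λ e → ≡.trans e (≡.cong (length v +_) (length-map (m +_) w)))
                  (All-length-shuffle v (w ↑ m) (widen m n pv) (shift m n pw)))

module _ {c ℓ} (F : Field c ℓ) where
  open Field F
  open Algebra𝐖 F
  open import Relation.Binary.Reasoning.Setoid setoid
  open import Algebra.Properties.CommutativeSemigroup *-commutativeSemigroup using (interchange)
  open import Algebra.Properties.Semiring.Mult semiring using (_×_; ×1-homo-*)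

  ι≡×1# : ∀ n → ι n ≡ n × 1#
  ι≡×1# zero    = ≡.refl
  ι≡×1# (suc n) = ≡.cong (1# +_) (ι≡×1# n)

  ι-homo-* : ∀ m n → ι (m Nat.* n) ≈ ι m * ι n
  ι-homo-* m n = begin
    ι (m Nat.* n)        ≡⟨ ι≡×1# (m Nat.* n) ⟩
    (m Nat.* n) × 1#     ≈⟨ ×1-homo-* m n ⟩
    (m × 1#) * (n × 1#)  ≡⟨ ≡.cong₂ _*_ (ι≡×1# m) (ι≡×1# n) ⟨
    ι m * ι n ∎

  *-inverse-unique : ∀ {x y z} → x * y ≈ 1# → x * z ≈ 1# → y ≈ z
  *-inverse-unique {x} {y} {z} xy≈1 xz≈1 = begin
    y             ≈⟨ *-identityʳ y ⟨
    y * 1#        ≈⟨ *-congˡ xz≈1 ⟨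
    y * (x * z)   ≈⟨ *-assoc y x z ⟨
    (y * x) * z   ≈⟨ *-congʳ (*-comm y x) ⟩
    (x * y) * z   ≈⟨ *-congʳ xy≈1 ⟩
    1# * z        ≈⟨ *-identityˡ z ⟩
    z ∎

  module _ (f : Basis → Carrier) where

    Σᴮ : List Basis → Carrier
    Σᴮ []      = 0#
    Σᴮ (b ∷ L) = f b + Σᴮ L

    Σᴮ-const : ∀ {k} L → All (λ b → f b ≈ k) L → Σᴮ L ≈ ι (length L) * k
    Σᴮ-const         []      []            = sym (zeroˡ _)
    Σᴮ-const {k = k} (b ∷ L) (fb≈k ∷ fL≈k) = begin
      f b + Σᴮ L                ≈⟨ +-cong fb≈k (Σᴮ-const L fL≈k) ⟩
      k + ι (length L) * k      ≈⟨ +-congʳ (*-identityˡ k) ⟨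
      1# * k + ι (length L) * k ≈⟨ distribʳ k 1# (ι (length L)) ⟨
      (1# + ι (length L)) * k ∎

    linExt-++ : ∀ x y → linExt f (x +𝐖 y) ≈ linExt f x + linExt f y
    linExt-++ []            y = sym (+-identityˡ _)
    linExt-++ ((a , b) ∷ x) y =
      trans (+-congˡ (linExt-++ x y)) (sym (+-assoc (a * f b) (linExt f x) (linExt f y)))

    linExt-• : ∀ a x → linExt f (a • x) ≈ a * linExt f x
    linExt-• a []             = sym (zeroʳ a)
    linExt-• a ((a' , b) ∷ x) = begin
      a * a' * f b + linExt f (a • x)  ≈⟨ +-cong (*-assoc a a' (f b)) (linExt-• a x) ⟩
      a * (a' * f b) + a * linExt f x  ≈⟨ distribˡ a (a' * f b) (linExt f x) ⟨
      a * (a' * f b + linExt f x) ∎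

    linExt-scaled : ∀ a L → linExt f (map (λ b → (a , b)) L) ≈ a * Σᴮ L
    linExt-scaled a []      = sym (zeroʳ a)
    linExt-scaled a (b ∷ L) = trans (+-congˡ (linExt-scaled a L)) (sym (distribˡ a (f b) (Σᴮ L)))

    linExt-1𝐖 : linExt f 1𝐖 ≈ f 1ᴮ
    linExt-1𝐖 = trans (+-identityʳ _) (*-identityˡ _)

    linExt-·𝐖 : (∀ b b' → Σᴮ (b ·ᴮ b') ≈ f b * f b') →
                ∀ x y → linExt f (x ·𝐖 y) ≈ linExt f x * linExt f y
    linExt-·𝐖 f-·ᴮ []            y = sym (zeroˡ _)
    linExt-·𝐖 f-·ᴮ ((a , b) ∷ x) y = begin
      linExt f (row a b y ++ (x ·𝐖 y))                ≈⟨ linExt-++ (row a b y) (x ·𝐖 y) ⟩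
      linExt f (row a b y) + linExt f (x ·𝐖 y)        ≈⟨ +-cong (linExt-row a b y) (linExt-·𝐖 f-·ᴮ x y) ⟩
      (a * f b) * linExt f y + linExt f x * linExt f y ≈⟨ distribʳ _ _ _ ⟨
      (a * f b + linExt f x) * linExt f y ∎
      where
      row : Carrier → Basis → 𝐖 → 𝐖
      row a b = concatMap (λ q → map (λ b' → (a * proj₁ q , b')) (b ·ᴮ proj₂ q))

      linExt-row : ∀ a b y → linExt f (row a b y) ≈ (a * f b) * linExt f y
      linExt-row a b []              = sym (zeroʳ _)
      linExt-row a b ((a' , b') ∷ y) = begin
        linExt f (map (λ z → (a * a' , z)) (b ·ᴮ b') ++ row a b y)
          ≈⟨ linExt-++ (map (λ z → (a * a' , z)) (b ·ᴮ b')) (row a b y) ⟩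
        linExt f (map (λ z → (a * a' , z)) (b ·ᴮ b')) + linExt f (row a b y)
          ≈⟨ +-cong (trans (linExt-scaled (a * a') (b ·ᴮ b')) (*-congˡ (f-·ᴮ b b'))) (linExt-row a b y) ⟩
        (a * a') * (f b * f b') + (a * f b) * linExt f y
          ≈⟨ +-congʳ (interchange a a' (f b) (f b')) ⟩
        (a * f b) * (a' * f b') + (a * f b) * linExt f y
          ≈⟨ distribˡ _ _ _ ⟨
        (a * f b) * (a' * f b' + linExt f y) ∎

  module _ (chz : CharZero) where

    1/! : ℕ → Carrier
    1/! n = inv-ι chz (n !) {{n !≢0}}

    ι-*-inv-ι : ∀ n .{{_ : NonZero n}} → ι n * inv-ι chz n ≈ 1#
    ι-*-inv-ι (suc k) = inv-r (ι (suc k)) (chz k)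

    1/0!≈1# : 1/! 0 ≈ 1#
    1/0!≈1# = *-inverse-unique (ι-*-inv-ι 1) (trans (*-identityʳ _) (+-identityʳ 1#))

    shuffleCount-*-1/! : ∀ a b → ι (shuffleCount a b) * 1/! (a Nat.+ b) ≈ 1/! a * 1/! b
    shuffleCount-*-1/! a b = *-inverse-unique {x = ι (a !) * ι (b !)} via-count via-factors
      where
      N = ι (shuffleCount a b)
      count-identity : N * ι (a !) * ι (b !) ≈ ι ((a Nat.+ b) !)
      count-identity = begin
        N * ι (a !) * ι (b !)                     ≈⟨ *-congʳ (ι-homo-* (shuffleCount a b) (a !)) ⟨
        ι (shuffleCount a b Nat.* a !) * ι (b !)  ≈⟨ ι-homo-* (shuffleCount a b Nat.* a !) (b !) ⟨
        ι (shuffleCount a b Nat.* a ! Nat.* b !)  ≡⟨ ≡.cong ι (shuffleCount-*-!-* a b) ⟩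
        ι ((a Nat.+ b) !) ∎
      via-count : (ι (a !) * ι (b !)) * (N * 1/! (a Nat.+ b)) ≈ 1#
      via-count = begin
        (ι (a !) * ι (b !)) * (N * 1/! (a Nat.+ b)) ≈⟨ *-assoc _ N _ ⟨
        ((ι (a !) * ι (b !)) * N) * 1/! (a Nat.+ b) ≈⟨ *-congʳ (trans (*-comm _ N) (sym (*-assoc N _ _))) ⟩
        (N * ι (a !) * ι (b !)) * 1/! (a Nat.+ b)   ≈⟨ *-congʳ count-identity ⟩
        ι ((a Nat.+ b) !) * 1/! (a Nat.+ b)         ≈⟨ ι-*-inv-ι ((a Nat.+ b) !) {{(a Nat.+ b) !≢0}} ⟩
        1# ∎
      via-factors : (ι (a !) * ι (b !)) * (1/! a * 1/! b) ≈ 1#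
      via-factors = begin
        (ι (a !) * ι (b !)) * (1/! a * 1/! b)   ≈⟨ interchange _ _ _ _ ⟩
        (ι (a !) * 1/! a) * (ι (b !) * 1/! b)   ≈⟨ *-cong (ι-*-inv-ι (a !) {{a !≢0}}) (ι-*-inv-ι (b !) {{b !≢0}}) ⟩
        1# * 1#                                 ≈⟨ *-identityˡ 1# ⟩
        1# ∎

    φ₀-·ᴮ : ∀ b b' → Σᴮ (φ₀ chz) (b ·ᴮ b') ≈ φ₀ chz b * φ₀ chz b'
    φ₀-·ᴮ b b' = begin
      Σᴮ (φ₀ chz) (b ·ᴮ b')
        ≈⟨ Σᴮ-const (φ₀ chz) (b ·ᴮ b') φ₀≈1/! ⟩
      ι (length (b ·ᴮ b')) * 1/! (|b| Nat.+ |b'|)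
        ≡⟨ ≡.cong (λ k → ι k * 1/! (|b| Nat.+ |b'|)) (length-·ᴮ b b') ⟩
      ι (shuffleCount |b| |b'|) * 1/! (|b| Nat.+ |b'|)
        ≈⟨ shuffleCount-*-1/! |b| |b'| ⟩
      1/! |b| * 1/! |b'| ∎
      where
      |b|  = wordLength b
      |b'| = wordLength b'
      φ₀≈1/! : All (λ b″ → φ₀ chz b″ ≈ 1/! (|b| Nat.+ |b'|)) (b ·ᴮ b')
      φ₀≈1/! = All.map (λ e → reflexive (≡.cong 1/! e)) (All-wordLength-·ᴮ b b')

corollary3p6 : ∀ {c ℓ} (F : Field c ℓ) (chz : Field.CharZero F) →
    Algebra𝐖.IsAlgebraMorphism F (Algebra𝐖.φ F chz)
corollary3p6 F chz = record
  { +-hom = linExt-++ F f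
  ; •-hom = linExt-• F f
  ; ·-hom = linExt-·𝐖 F f (φ₀-·ᴮ F chz)
  ; 1-hom = Field.trans F (linExt-1𝐖 F f) (1/0!≈1# F chz)
  }
  where f = Algebra𝐖.φ₀ F chz
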